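{- For a permutation $\pi=\pi_1\cdots\pi_m$ define $m_{I}(\pi)=\#\{i:\exists j>i,\ \pi_j>\pi_i\}$, $m_{II}(\pi)=\#\{i:\exists j<i,\ \pi_j>\pi_i\}$, $m_{III}(\pi)=\#\{i:\exists j<i,\ \pi_j<\pi_i\}$, $m_{IV}(\pi)=\#\{i:\exists j>i,\ \pi_j<\pi_i\}$. Let $UD_m$ (resp. $DU_m$) be the set of up-down (resp. down-up) permutations of $\{1,\dots,m\}$, and for $n\ge1$ let $A_{2n}(p,q)=\sum_{\pi\in UD_{2n}}p^{m_{II}(\pi)}q^{m_I(\pi)}$, $B_{2n-1}(p,q)=\sum_{\pi\in UD_{2n-1}}p^{m_{II}(\pi)}q^{m_I(\pi)}$, $C_{2n}(p,q)=\sum_{\pi\in DU_{2n}}p^{m_{II}(\pi)}q^{m_I(\pi)}$, $D_{2n-1}(p,q)=\sum_{\pi\in DU_{2n-1}}p^{m_{II}(\pi)}q^{m_I(\pi)}$. Then for all $n\ge1$: 1. $A_{2n}(p,q)=\sum_{\pi\in DU_{2n}}p^{m_I(\pi)}q^{m_{II}(\pi)}=\sum_{\pi\in DU_{2n}}p^{m_{III}(\pi)}q^{m_{IV}(\pi)}=\sum_{\pi\in UD_{2n}}p^{m_{IV}(\pi)}q^{m_{III}(\pi)}$; 2. $B_{2n-1}(p,q)=\sum_{\pi\in UD_{2n-1}}p^{m_I(\pi)}q^{m_{II}(\pi)}=\sum_{\pi\in DU_{2n-1}}p^{m_{III}(\pi)}q^{m_{IV}(\pi)}=\sum_{\pi\in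 DU_{2n-1}}p^{m_{IV}(\pi)}q^{m_{III}(\pi)}$; 3. $C_{2n}(p,q)=\sum_{\pi\in UD_{2n}}p^{m_I(\pi)}q^{m_{II}(\pi)}=\sum_{\pi\in UD_{2n}}p^{m_{III}(\pi)}q^{m_{IV}(\pi)}=\sum_{\pi\in DU_{2n}}p^{m_{IV}(\pi)}q^{m_{III}(\pi)}$; 4. $D_{2n-1}(p,q)=\sum_{\pi\in DU_{2n-1}}p^{m_I(\pi)}q^{m_{II}(\pi)}=\sum_{\pi\in UD_{2n-1}}p^{m_{III}(\pi)}q^{m_{IV}(\pi)}=\sum_{\pi\in UD_{2n-1}}p^{m_{IV}(\pi)}q^{m_{III}(\pi)}$.
   Context: Up-down: $\pi_1<\pi_2>\pi_3<\cdots$; down-up: $\pi_1>\pi_2<\pi_3>\cdots$. In the paper's notation, $m_I,m_{II},m_{III},m_{IV}$ are the numbers of occurrences of the quadrant marked mesh patterns MMP$(1,0,0,0)$, MMP$(0,1,0,0)$, MMP$(0,0,1,0)$, MMP$(0,0,0,1)$, i.e. the numbers of non-right-to-left maxima, non-left-to-right maxima, non-left-to-right minima and non-right-to-left minima, respectively. -}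

module Defs where

open import Level using (Level)
open import Data.Bool using (Bool; true; false; _∧_; _∨_; not; if_then_else_)
open import Data.Nat using (ℕ; zero; suc; _<ᵇ_)
open import Data.Fin using (Fin; toℕ; _<_)
open import Data.List using (List; []; _∷_; map; concatMap; filter; length; allFin; foldr)
open import Data.Vec using (Vec; []; _∷_; lookup; toList)
open import Data.Fin.Properties using (_<?_)
open import Relation.Nullary.Decidable using (does)
open import Relation.Binary.PropositionalEquality using (_≡_)
open import Data.Bool.Properties using (_≟_)
open import Algebra.Bundles using (CommutativeSemiring)

-- A permutation of {1,…,m} is represented as a word π = π₁⋯πₘ, i.e. a
-- vector of length m over Fin m (value v ∈ Fin m stands for v+1), whose
-- entries are pairwise distinct.

words : (k m : ℕ) → List (Vec (Fin m) k)
words zero    m = [] ∷ []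
words (suc k) m = concatMap (λ x → map (x ∷_) (words k m)) (allFin m)

anyB : {A : Set} → (A → Bool) → List A → Bool
anyB f []       = false
anyB f (x ∷ xs) = f x ∨ anyB f xs

countB : {A : Set} → (A → Bool) → List A → ℕ
countB f xs = length (filter (λ x → f x ≟ true) xs)

lt : {m : ℕ} → Fin m → Fin m → Bool
lt a b = toℕ a <ᵇ toℕ b

distinct : {m : ℕ} → List (Fin m) → Bool
distinct []       = true
distinct (x ∷ xs) = not (anyB (λ y → toℕ x Data.Nat.≡ᵇ toℕ y) xs) ∧ distinct xs

alt : {m : ℕ} → Bool → List (Fin m) → Bool
alt up (x ∷ y ∷ rest) = (if up then lt x y else lt y x) ∧ alt (not up) (y ∷ rest)
alt up _              = true

alternating : Bool → (m : ℕ) → List (Vec (Fin m) m)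
alternating up m =
  filter (λ π → (distinct (toList π) ∧ alt up (toList π)) ≟ true) (words m m)

UD DU : (m : ℕ) → List (Vec (Fin m) m)
UD = alternating true
DU = alternating false

-- positions (0-based) i, j of a word of length m
mI mII mIII mIV : {m : ℕ} → Vec (Fin m) m → ℕ
mI   {m} π = countB (λ i → anyB (λ j → lt i j ∧ lt (lookup π i) (lookup π j)) (allFin m)) (allFin m)
mII  {m} π = countB (λ i → anyB (λ j → lt j i ∧ lt (lookup π i) (lookup π j)) (allFin m)) (allFin m)
mIII {m} π = countB (λ i → anyB (λ j → lt j i ∧ lt (lookup π j) (lookup π i)) (allFin m)) (allFin m)
mIV  {m} π = countB (λ i → anyB (λ j → lt i j ∧ lt (lookup π j) (lookup π i)) (allFin m)) (allFin m)

module _ {c ℓ : Level} (R : CommutativeSemiring c ℓ) where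
  open CommutativeSemiring R

  pow : Carrier → ℕ → Carrier
  pow x zero    = 1#
  pow x (suc k) = x * pow x k

  GF : {m : ℕ} → List (Vec (Fin m) m) → (Vec (Fin m) m → ℕ) → (Vec (Fin m) m → ℕ)
       → Carrier → Carrier → Carrier
  GF S f g p q = foldr (λ π acc → pow p (f π) * pow q (g π) + acc) 0# S

{-# OPTIONS --safe #-}
-- Reversal π ↦ πʳ and complementation π ↦ πᶜ (πᶜᵢ = m + 1 − πᵢ) are bijections of the
-- set of words of length m over {1,…,m}, so they preserve sums over all such words.
-- Reversal exchanges m_I with m_II and m_III with m_IV; it exchanges UD_m with DU_m when
-- m is even and preserves both when m is odd. Complementation turns m_II, m_I into
-- m_III, m_IV and always exchanges UD_m with DU_m. Transporting the generating function
-- along πʳ, πᶜ and πᶜʳ gives the three identities of each item.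

module Submission where

open import Defs
open import Level using (Level)
open import Data.Nat using (ℕ; _*_; _∸_; _≤_)
open import Data.Product using (_×_; _,_)
open import Algebra.Bundles using (CommutativeSemiring; CommutativeMonoid)

open import Data.Bool using (Bool; true; false; not; _∧_; _∨_; if_then_else_; T)
open import Data.Bool.Properties
  using (_≟_; ∧-comm; ∧-assoc; ∧-identityʳ; not-involutive; ∨-commutativeMonoid)
open import Algebra.Properties.CommutativeSemigroup
  (CommutativeMonoid.commutativeSemigroup ∨-commutativeMonoid) using (x∙yz≈y∙xz)
open import Data.Nat as ℕ using (zero; suc; s≤s; _≡ᵇ_)
open import Data.Nat.Properties
  using (+-0-commutativeMonoid; +-suc; <ᵇ⇒<; <⇒<ᵇ; ≡ᵇ⇒≡; ≡⇒≡ᵇ; ∸-monoʳ-<)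
open import Data.Fin as Fin using (Fin; zero; suc; opposite; fromℕ; inject₁; toℕ)
open import Data.Fin.Properties
  using (opposite-prop; opposite-involutive; toℕ<n; toℕ-injective)
open import Data.Fin.Permutation as Perm using (Permutation′; _⟨$⟩ʳ_)
open import Data.List as List
  using (List; []; _∷_; _++_; [_]; filter; concatMap; allFin; length)
open import Data.List.Properties using (unfold-reverse; ++-assoc; length-reverse)
open import Data.Vec as Vec using (Vec; []; _∷_; _∷ʳ_; lookup; toList)
open import Data.Vec.Properties
  using (reverse-∷; lookup-map; toList-map; toList-reverse; length-toList)
open import Function using (_∘_; flip; id)
open import Relation.Binary.PropositionalEquality
  using (_≡_; refl; sym; trans; cong; cong₂; subst₂; module ≡-Reasoning)
open import Relation.Nullary.Reflects using (fromEquivalence; T-reflects-elim)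

module Summation {a ℓ} (M : CommutativeMonoid a ℓ) where
  open CommutativeMonoid M
    renaming (_∙_ to _+_; ε to 0#; ∙-cong to +-cong; ∙-congˡ to +-congˡ;
              identityˡ to +-identityˡ; identityʳ to +-identityʳ; assoc to +-assoc;
              refl to ≈-refl; sym to ≈-sym; trans to ≈-trans; reflexive to ≈-reflexive)
  open import Algebra.Properties.CommutativeMonoid.Sum M
    using (sum; sum-syntax; sum-cong-≋; ∑-comm; ∑-permute)
  open import Relation.Binary.Reasoning.Setoid setoid

  sumList : {A : Set} → (A → Carrier) → List A → Carrier
  sumList h = List.foldr (λ x acc → h x + acc) 0#

  sumList-cong : {A : Set} {f g : A → Carrier} (xs : List A) →
                 (∀ x → f x ≈ g x) → sumList f xs ≈ sumList g xs
  sumList-cong []       f≈g = ≈-refl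
  sumList-cong (x ∷ xs) f≈g = +-cong (f≈g x) (sumList-cong xs f≈g)

  sumList-++ : {A : Set} (h : A → Carrier) (xs ys : List A) →
               sumList h (xs ++ ys) ≈ sumList h xs + sumList h ys
  sumList-++ h []       ys = ≈-sym (+-identityˡ _)
  sumList-++ h (x ∷ xs) ys = ≈-trans (+-congˡ (sumList-++ h xs ys)) (≈-sym (+-assoc _ _ _))

  sumList-map : {A B : Set} (h : B → Carrier) (f : A → B) (xs : List A) →
                sumList h (List.map f xs) ≡ sumList (h ∘ f) xs
  sumList-map h f []       = refl
  sumList-map h f (x ∷ xs) = cong (h (f x) +_) (sumList-map h f xs)

  sumList-concatMap : {A B : Set} (h : B → Carrier) (F : A → List B) (xs : List A) →
                      sumList h (concatMap F xs) ≈ sumList (sumList h ∘ F) xs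
  sumList-concatMap h F []       = ≈-refl
  sumList-concatMap h F (x ∷ xs) =
    ≈-trans (sumList-++ h (F x) (concatMap F xs)) (+-congˡ (sumList-concatMap h F xs))

  sumList-filter : {A : Set} (h : A → Carrier) (b : A → Bool) (xs : List A) →
                   sumList h (filter (λ x → b x ≟ true) xs)
                   ≈ sumList (λ x → if b x then h x else 0#) xs
  sumList-filter h b []       = ≈-refl
  sumList-filter h b (x ∷ xs) with b x
  ... | true  = +-congˡ (sumList-filter h b xs)
  ... | false = ≈-trans (sumList-filter h b xs) (≈-sym (+-identityˡ _))

  sumList-tabulate : {A : Set} {n : ℕ} (h : A → Carrier) (f : Fin n → A) →
                     sumList h (List.tabulate f) ≡ sum (h ∘ f)
  sumList-tabulate {n = zero}  h f = refl
  sumList-tabulate {n = suc n} h f = cong (h (f zero) +_) (sumList-tabulate h (f ∘ suc))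

  sumList-allFin-permute : {n : ℕ} (σ : Permutation′ n) (h : Fin n → Carrier) →
                           sumList (h ∘ (σ ⟨$⟩ʳ_)) (allFin n) ≈ sumList h (allFin n)
  sumList-allFin-permute {n} σ h = begin
    sumList (h ∘ (σ ⟨$⟩ʳ_)) (allFin n) ≡⟨ sumList-tabulate (h ∘ (σ ⟨$⟩ʳ_)) id ⟩
    ∑[ i < n ] h (σ ⟨$⟩ʳ i)            ≈⟨ ∑-permute h σ ⟨
    ∑[ i < n ] h i                      ≡⟨ sumList-tabulate h id ⟨
    sumList h (allFin n)                ∎

  wordSum : {m : ℕ} (k : ℕ) → (Vec (Fin m) k → Carrier) → Carrier
  wordSum         zero    h = h []
  wordSum {m = m} (suc k) h = ∑[ x < m ] wordSum k (λ w → h (x ∷ w))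

  wordSum-cong : {m : ℕ} (k : ℕ) {f g : Vec (Fin m) k → Carrier} →
                 (∀ w → f w ≈ g w) → wordSum k f ≈ wordSum k g
  wordSum-cong zero    f≈g = f≈g []
  wordSum-cong (suc k) f≈g = sum-cong-≋ (λ x → wordSum-cong k (λ w → f≈g (x ∷ w)))

  sumList-words : (k m : ℕ) (h : Vec (Fin m) k → Carrier) →
                  sumList h (words k m) ≈ wordSum k h
  sumList-words zero    m h = +-identityʳ (h [])
  sumList-words (suc k) m h = begin
    sumList h (concatMap (λ x → List.map (x ∷_) (words k m)) (allFin m))
      ≈⟨ sumList-concatMap h _ (allFin m) ⟩
    sumList (λ x → sumList h (List.map (x ∷_) (words k m))) (allFin m)
      ≈⟨ sumList-cong (allFin m) (λ x →
           ≈-trans (≈-reflexive (sumList-map h (x ∷_) (words k m))) (sumList-words k m _)) ⟩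
    sumList (λ x → wordSum k (λ w → h (x ∷ w))) (allFin m)
      ≡⟨ sumList-tabulate (λ x → wordSum k (λ w → h (x ∷ w))) id ⟩
    wordSum (suc k) h ∎

  wordSum-∷ʳ : {m : ℕ} (k : ℕ) (h : Vec (Fin m) (suc k) → Carrier) →
               wordSum (suc k) h ≈ ∑[ x < m ] wordSum k (λ w → h (w ∷ʳ x))
  wordSum-∷ʳ zero    h = ≈-refl
  wordSum-∷ʳ (suc k) h = ≈-trans
    (sum-cong-≋ (λ y → wordSum-∷ʳ k (λ u → h (y ∷ u))))
    (∑-comm (λ y x → wordSum k (λ w → h (y ∷ (w ∷ʳ x)))))

  wordSum-reverse : {m : ℕ} (k : ℕ) (h : Vec (Fin m) k → Carrier) →
                    wordSum k (h ∘ Vec.reverse) ≈ wordSum k h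
  wordSum-reverse         zero    h = ≈-refl
  wordSum-reverse {m = m} (suc k) h = begin
    ∑[ x < m ] wordSum k (λ w → h (Vec.reverse (x ∷ w)))
      ≈⟨ sum-cong-≋ (λ x → wordSum-cong k (λ w → ≈-reflexive (cong h (reverse-∷ x w)))) ⟩
    ∑[ x < m ] wordSum k (λ w → h (Vec.reverse w ∷ʳ x))
      ≈⟨ sum-cong-≋ (λ x → wordSum-reverse k (λ u → h (u ∷ʳ x))) ⟩
    ∑[ x < m ] wordSum k (λ w → h (w ∷ʳ x))
      ≈⟨ wordSum-∷ʳ k h ⟨
    wordSum (suc k) h ∎

  wordSum-permute : {m : ℕ} (σ : Permutation′ m) (k : ℕ) (h : Vec (Fin m) k → Carrier) →
                    wordSum k (h ∘ Vec.map (σ ⟨$⟩ʳ_)) ≈ wordSum k h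
  wordSum-permute         σ zero    h = ≈-refl
  wordSum-permute {m = m} σ (suc k) h = begin
    ∑[ x < m ] wordSum k (λ w → h ((σ ⟨$⟩ʳ x) ∷ Vec.map (σ ⟨$⟩ʳ_) w))
      ≈⟨ sum-cong-≋ (λ x → wordSum-permute σ k (λ w → h ((σ ⟨$⟩ʳ x) ∷ w))) ⟩
    ∑[ x < m ] wordSum k (λ w → h ((σ ⟨$⟩ʳ x) ∷ w))
      ≈⟨ ∑-permute (λ x → wordSum k (λ w → h (x ∷ w))) σ ⟨
    wordSum (suc k) h ∎

  sumList-filter-words-transport :
    {m k : ℕ} (φ : Vec (Fin m) k → Vec (Fin m) k) → (∀ h → wordSum k (h ∘ φ) ≈ wordSum k h) →
    {b₁ b₂ : Vec (Fin m) k → Bool} {h₁ h₂ : Vec (Fin m) k → Carrier} →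
    (∀ w → b₂ (φ w) ≡ b₁ w) → (∀ w → h₂ (φ w) ≈ h₁ w) →
    sumList h₁ (filter (λ w → b₁ w ≟ true) (words k m))
    ≈ sumList h₂ (filter (λ w → b₂ w ≟ true) (words k m))
  sumList-filter-words-transport {m} {k} φ φ-invariant {b₁} {b₂} {h₁} {h₂} b-eq h-eq = begin
    sumList h₁ (filter (λ w → b₁ w ≟ true) (words k m)) ≈⟨ sumList-filter h₁ b₁ (words k m) ⟩
    sumList (guarded b₁ h₁) (words k m)                 ≈⟨ sumList-words k m _ ⟩
    wordSum k (guarded b₁ h₁)                           ≈⟨ wordSum-cong k guarded-eq ⟩
    wordSum k (guarded b₂ h₂ ∘ φ)                       ≈⟨ φ-invariant _ ⟩
    wordSum k (guarded b₂ h₂)                           ≈⟨ sumList-words k m _ ⟨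
    sumList (guarded b₂ h₂) (words k m)                 ≈⟨ sumList-filter h₂ b₂ (words k m) ⟨
    sumList h₂ (filter (λ w → b₂ w ≟ true) (words k m)) ∎
    where
    guarded : (Vec (Fin m) k → Bool) → (Vec (Fin m) k → Carrier) → Vec (Fin m) k → Carrier
    guarded b h w = if b w then h w else 0#

    guarded-eq : ∀ w → guarded b₁ h₁ w ≈ guarded b₂ h₂ (φ w)
    guarded-eq w rewrite b-eq w with b₁ w
    ... | true  = ≈-sym (h-eq w)
    ... | false = ≈-refl

module ∨-Sum = Summation ∨-commutativeMonoid
module +-Sum = Summation +-0-commutativeMonoid

open ≡-Reasoning

T-injective : {a b : Bool} → (T a → T b) → (T b → T a) → a ≡ b
T-injective to from = T-reflects-elim (fromEquivalence to from)

opposite-< : {n : ℕ} (i j : Fin n) → i Fin.< j → opposite j Fin.< opposite i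
opposite-< i j i<j = subst₂ ℕ._<_ (sym (opposite-prop j)) (sym (opposite-prop i))
  (∸-monoʳ-< (s≤s i<j) (toℕ<n j))

opposite-<⁻¹ : {n : ℕ} (i j : Fin n) → opposite j Fin.< opposite i → i Fin.< j
opposite-<⁻¹ i j oj<oi =
  subst₂ Fin._<_ (opposite-involutive i) (opposite-involutive j) (opposite-< _ _ oj<oi)

opposite-injective : {n : ℕ} {i j : Fin n} → opposite i ≡ opposite j → i ≡ j
opposite-injective {i = i} {j} oi≡oj =
  trans (sym (opposite-involutive i)) (trans (cong opposite oi≡oj) (opposite-involutive j))

lt-opposite : {n : ℕ} (i j : Fin n) → lt (opposite i) (opposite j) ≡ lt j i
lt-opposite i j = T-injective
  (<⇒<ᵇ ∘ opposite-<⁻¹ j i ∘ <ᵇ⇒< (toℕ (opposite i)) (toℕ (opposite j)))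
  (<⇒<ᵇ ∘ opposite-< j i ∘ <ᵇ⇒< (toℕ j) (toℕ i))

eqᵇ : {n : ℕ} → Fin n → Fin n → Bool
eqᵇ i j = toℕ i ≡ᵇ toℕ j

eqᵇ⇒≡ : {n : ℕ} (i j : Fin n) → T (eqᵇ i j) → i ≡ j
eqᵇ⇒≡ i j = toℕ-injective ∘ ≡ᵇ⇒≡ (toℕ i) (toℕ j)

≡⇒eqᵇ : {n : ℕ} (i j : Fin n) → i ≡ j → T (eqᵇ i j)
≡⇒eqᵇ i j = ≡⇒≡ᵇ (toℕ i) (toℕ j) ∘ cong toℕ

eqᵇ-sym : {n : ℕ} (i j : Fin n) → eqᵇ i j ≡ eqᵇ j i
eqᵇ-sym i j = T-injective (≡⇒eqᵇ j i ∘ sym ∘ eqᵇ⇒≡ i j) (≡⇒eqᵇ i j ∘ sym ∘ eqᵇ⇒≡ j i)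

eqᵇ-opposite : {n : ℕ} (i j : Fin n) → eqᵇ (opposite i) (opposite j) ≡ eqᵇ i j
eqᵇ-opposite i j = T-injective
  (≡⇒eqᵇ i j ∘ opposite-injective ∘ eqᵇ⇒≡ (opposite i) (opposite j))
  (≡⇒eqᵇ (opposite i) (opposite j) ∘ cong opposite ∘ eqᵇ⇒≡ i j)

anyB-cong : {A : Set} {f g : A → Bool} (xs : List A) →
            (∀ x → f x ≡ g x) → anyB f xs ≡ anyB g xs
anyB-cong []       f≗g = refl
anyB-cong (x ∷ xs) f≗g = cong₂ _∨_ (f≗g x) (anyB-cong xs f≗g)

anyB-map : {A B : Set} (f : B → Bool) (g : A → B) (xs : List A) →
           anyB f (List.map g xs) ≡ anyB (f ∘ g) xs
anyB-map f g []       = refl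
anyB-map f g (x ∷ xs) = cong (f (g x) ∨_) (anyB-map f g xs)

anyB-∷ʳ : {A : Set} (f : A → Bool) (xs : List A) (y : A) →
          anyB f (xs ++ [ y ]) ≡ f y ∨ anyB f xs
anyB-∷ʳ f []       y = refl
anyB-∷ʳ f (x ∷ xs) y =
  trans (cong (f x ∨_) (anyB-∷ʳ f xs y)) (x∙yz≈y∙xz (f x) (f y) (anyB f xs))

anyB-reverse : {A : Set} (f : A → Bool) (xs : List A) → anyB f (List.reverse xs) ≡ anyB f xs
anyB-reverse f []       = refl
anyB-reverse f (x ∷ xs) = begin
  anyB f (List.reverse (x ∷ xs))    ≡⟨ cong (anyB f) (unfold-reverse x xs) ⟩
  anyB f (List.reverse xs ++ [ x ]) ≡⟨ anyB-∷ʳ f (List.reverse xs) x ⟩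
  f x ∨ anyB f (List.reverse xs)    ≡⟨ cong (f x ∨_) (anyB-reverse f xs) ⟩
  f x ∨ anyB f xs                   ∎

anyB-as-sum : {A : Set} (f : A → Bool) (xs : List A) → anyB f xs ≡ ∨-Sum.sumList f xs
anyB-as-sum f []       = refl
anyB-as-sum f (x ∷ xs) = cong (f x ∨_) (anyB-as-sum f xs)

countB-as-sum : {A : Set} (f : A → Bool) (xs : List A) →
                countB f xs ≡ +-Sum.sumList (λ x → if f x then 1 else 0) xs
countB-as-sum f xs = +-Sum.sumList-filter (λ _ → 1) f xs

countB-cong : {A : Set} {f g : A → Bool} (xs : List A) →
              (∀ x → f x ≡ g x) → countB f xs ≡ countB g xs
countB-cong {f = f} {g} xs f≗g = begin
  countB f xs
    ≡⟨ countB-as-sum f xs ⟩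
  +-Sum.sumList (λ x → if f x then 1 else 0) xs
    ≡⟨ +-Sum.sumList-cong xs (λ x → cong (if_then 1 else 0) (f≗g x)) ⟩
  +-Sum.sumList (λ x → if g x then 1 else 0) xs
    ≡⟨ countB-as-sum g xs ⟨
  countB g xs ∎

anyB-allFin-permute : {n : ℕ} (σ : Permutation′ n) (f : Fin n → Bool) →
                      anyB (f ∘ (σ ⟨$⟩ʳ_)) (allFin n) ≡ anyB f (allFin n)
anyB-allFin-permute {n} σ f = begin
  anyB (f ∘ (σ ⟨$⟩ʳ_)) (allFin n)          ≡⟨ anyB-as-sum _ (allFin n) ⟩
  ∨-Sum.sumList (f ∘ (σ ⟨$⟩ʳ_)) (allFin n) ≡⟨ ∨-Sum.sumList-allFin-permute σ f ⟩
  ∨-Sum.sumList f (allFin n)               ≡⟨ anyB-as-sum f (allFin n) ⟨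
  anyB f (allFin n)                        ∎

countB-allFin-permute : {n : ℕ} (σ : Permutation′ n) (f : Fin n → Bool) →
                        countB (f ∘ (σ ⟨$⟩ʳ_)) (allFin n) ≡ countB f (allFin n)
countB-allFin-permute {n} σ f = begin
  countB (f ∘ (σ ⟨$⟩ʳ_)) (allFin n)                ≡⟨ countB-as-sum _ (allFin n) ⟩
  +-Sum.sumList (indicator ∘ (σ ⟨$⟩ʳ_)) (allFin n) ≡⟨ +-Sum.sumList-allFin-permute σ indicator ⟩
  +-Sum.sumList indicator (allFin n)                ≡⟨ countB-as-sum f (allFin n) ⟨
  countB f (allFin n)                               ∎
  where
  indicator : Fin n → ℕ
  indicator i = if f i then 1 else 0

countWitnessed : {k : ℕ} → (Fin k → Fin k → Bool) → ℕ
countWitnessed {k} R = countB (λ i → anyB (R i) (allFin k)) (allFin k)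

countWitnessed-cong : {k : ℕ} {R S : Fin k → Fin k → Bool} →
                      (∀ i j → R i j ≡ S i j) → countWitnessed R ≡ countWitnessed S
countWitnessed-cong {k} R≗S = countB-cong (allFin k) (λ i → anyB-cong (allFin k) (R≗S i))

countWitnessed-permute : {k : ℕ} (σ : Permutation′ k) (R : Fin k → Fin k → Bool) →
  countWitnessed (λ i j → R (σ ⟨$⟩ʳ i) (σ ⟨$⟩ʳ j)) ≡ countWitnessed R
countWitnessed-permute {k} σ R = trans
  (countB-cong (allFin k) (λ i → anyB-allFin-permute σ (R (σ ⟨$⟩ʳ i))))
  (countB-allFin-permute σ (λ i → anyB (R i) (allFin k)))

-- mI, mII, mIII and mIV are, by definition, witnessCount pos val with pos, val ∈ {lt, flip lt}.
witnessCount : {m k : ℕ} → (Fin k → Fin k → Bool) → (Fin m → Fin m → Bool) → Vec (Fin m) k → ℕ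
witnessCount pos val π = countWitnessed (λ i j → pos i j ∧ val (lookup π i) (lookup π j))

lookup-∷ʳ-last : {A : Set} {n : ℕ} (xs : Vec A n) (x : A) → lookup (xs ∷ʳ x) (fromℕ n) ≡ x
lookup-∷ʳ-last []       x = refl
lookup-∷ʳ-last (_ ∷ xs) x = lookup-∷ʳ-last xs x

lookup-∷ʳ-inject₁ : {A : Set} {n : ℕ} (xs : Vec A n) (x : A) (i : Fin n) →
                    lookup (xs ∷ʳ x) (inject₁ i) ≡ lookup xs i
lookup-∷ʳ-inject₁ (_ ∷ xs) x zero    = refl
lookup-∷ʳ-inject₁ (_ ∷ xs) x (suc i) = lookup-∷ʳ-inject₁ xs x i

lookup-reverse : {A : Set} {n : ℕ} (xs : Vec A n) (i : Fin n) →
                 lookup (Vec.reverse xs) (opposite i) ≡ lookup xs i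
lookup-reverse (x ∷ xs) zero    = begin
  lookup (Vec.reverse (x ∷ xs)) (fromℕ _)
    ≡⟨ cong (λ v → lookup v (fromℕ _)) (reverse-∷ x xs) ⟩
  lookup (Vec.reverse xs ∷ʳ x) (fromℕ _)
    ≡⟨ lookup-∷ʳ-last (Vec.reverse xs) x ⟩
  x ∎
lookup-reverse (x ∷ xs) (suc i) = begin
  lookup (Vec.reverse (x ∷ xs)) (inject₁ (opposite i))
    ≡⟨ cong (λ v → lookup v (inject₁ (opposite i))) (reverse-∷ x xs) ⟩
  lookup (Vec.reverse xs ∷ʳ x) (inject₁ (opposite i))
    ≡⟨ lookup-∷ʳ-inject₁ (Vec.reverse xs) x (opposite i) ⟩
  lookup (Vec.reverse xs) (opposite i)
    ≡⟨ lookup-reverse xs i ⟩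
  lookup xs i ∎

witnessCount-reverse :
  {m k : ℕ} (pos : Fin k → Fin k → Bool) (val : Fin m → Fin m → Bool) (π : Vec (Fin m) k) →
  witnessCount pos val (Vec.reverse π)
  ≡ witnessCount (λ i j → pos (opposite i) (opposite j)) val π
witnessCount-reverse {m} {k} pos val π = begin
  countWitnessed (λ i j → pos i j ∧ val (lookup πʳ i) (lookup πʳ j))
    ≡⟨ countWitnessed-permute Perm.reverse
         (λ i j → pos i j ∧ val (lookup πʳ i) (lookup πʳ j)) ⟨
  countWitnessed (λ i j → pos (opposite i) (opposite j)
                          ∧ val (lookup πʳ (opposite i)) (lookup πʳ (opposite j)))
    ≡⟨ countWitnessed-cong (λ i j → cong₂ (λ a b → pos (opposite i) (opposite j) ∧ val a b)
                                          (lookup-reverse π i) (lookup-reverse π j)) ⟩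
  witnessCount (λ i j → pos (opposite i) (opposite j)) val π ∎
  where
  πʳ : Vec (Fin m) k
  πʳ = Vec.reverse π

witnessCount-map :
  {m k : ℕ} (pos : Fin k → Fin k → Bool) (val : Fin m → Fin m → Bool)
  (f : Fin m → Fin m) (π : Vec (Fin m) k) →
  witnessCount pos val (Vec.map f π) ≡ witnessCount pos (λ a b → val (f a) (f b)) π
witnessCount-map pos val f π = countWitnessed-cong (λ i j →
  cong₂ (λ a b → pos i j ∧ val a b) (lookup-map i f π) (lookup-map j f π))

module _ {m k : ℕ} (val : Fin m → Fin m → Bool) (π : Vec (Fin m) k) where

  witnessCount-reverse-lt : witnessCount lt val (Vec.reverse π) ≡ witnessCount (flip lt) val π
  witnessCount-reverse-lt = trans (witnessCount-reverse lt val π)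
    (countWitnessed-cong (λ i j → cong (_∧ val (lookup π i) (lookup π j)) (lt-opposite i j)))

  witnessCount-reverse-gt : witnessCount (flip lt) val (Vec.reverse π) ≡ witnessCount lt val π
  witnessCount-reverse-gt = trans (witnessCount-reverse (flip lt) val π)
    (countWitnessed-cong (λ i j → cong (_∧ val (lookup π i) (lookup π j)) (lt-opposite j i)))

witnessCount-complement : {m k : ℕ} (pos : Fin k → Fin k → Bool) (π : Vec (Fin m) k) →
  witnessCount pos (flip lt) (Vec.map opposite π) ≡ witnessCount pos lt π
witnessCount-complement pos π = trans (witnessCount-map pos (flip lt) opposite π)
  (countWitnessed-cong (λ i j → cong (pos i j ∧_) (lt-opposite (lookup π j) (lookup π i))))

not-∨-∧-interchange : (q p s d : Bool) → not (q ∨ p) ∧ (not s ∧ d) ≡ not (q ∨ s) ∧ (not p ∧ d)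
not-∨-∧-interchange true  p     s     d = refl
not-∨-∧-interchange false true  true  d = refl
not-∨-∧-interchange false true  false d = refl
not-∨-∧-interchange false false s     d = refl

distinct-∷ʳ : {n : ℕ} (xs : List (Fin n)) (y : Fin n) →
              distinct (xs ++ [ y ]) ≡ not (anyB (eqᵇ y) xs) ∧ distinct xs
distinct-∷ʳ []       y = refl
distinct-∷ʳ (x ∷ xs) y = begin
  not (anyB (eqᵇ x) (xs ++ [ y ])) ∧ distinct (xs ++ [ y ])
    ≡⟨ cong₂ (λ a b → not a ∧ b) (anyB-∷ʳ (eqᵇ x) xs y) (distinct-∷ʳ xs y) ⟩
  not (eqᵇ x y ∨ anyB (eqᵇ x) xs) ∧ (not (anyB (eqᵇ y) xs) ∧ distinct xs)
    ≡⟨ not-∨-∧-interchange (eqᵇ x y) (anyB (eqᵇ x) xs) (anyB (eqᵇ y) xs) (distinct xs) ⟩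
  not (eqᵇ x y ∨ anyB (eqᵇ y) xs) ∧ (not (anyB (eqᵇ x) xs) ∧ distinct xs)
    ≡⟨ cong (λ a → not (a ∨ anyB (eqᵇ y) xs) ∧ distinct (x ∷ xs)) (eqᵇ-sym x y) ⟩
  not (anyB (eqᵇ y) (x ∷ xs)) ∧ distinct (x ∷ xs) ∎

distinct-reverse : {n : ℕ} (xs : List (Fin n)) → distinct (List.reverse xs) ≡ distinct xs
distinct-reverse []       = refl
distinct-reverse (x ∷ xs) = begin
  distinct (List.reverse (x ∷ xs))
    ≡⟨ cong distinct (unfold-reverse x xs) ⟩
  distinct (List.reverse xs ++ [ x ])
    ≡⟨ distinct-∷ʳ (List.reverse xs) x ⟩
  not (anyB (eqᵇ x) (List.reverse xs)) ∧ distinct (List.reverse xs)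
    ≡⟨ cong₂ (λ a b → not a ∧ b) (anyB-reverse (eqᵇ x) xs) (distinct-reverse xs) ⟩
  distinct (x ∷ xs) ∎

distinct-map-opposite : {n : ℕ} (xs : List (Fin n)) →
                        distinct (List.map opposite xs) ≡ distinct xs
distinct-map-opposite []       = refl
distinct-map-opposite (x ∷ xs) = cong₂ (λ a b → not a ∧ b)
  (trans (anyB-map (eqᵇ (opposite x)) opposite xs) (anyB-cong xs (eqᵇ-opposite x)))
  (distinct-map-opposite xs)

-- flips k up is the direction of step k + 1 of an alternating word whose first step is up.
flips : ℕ → Bool → Bool
flips zero    up = up
flips (suc k) up = flips k (not up)

flips-not : (k : ℕ) (up : Bool) → flips k (not up) ≡ not (flips k up)
flips-not zero    up = refl
flips-not (suc k) up = flips-not k (not up)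

flips-double : (k : ℕ) (up : Bool) → flips (2 * k) up ≡ up
flips-double zero    up = refl
flips-double (suc k) up = begin
  flips (k ℕ.+ suc (k ℕ.+ 0)) (not up) ≡⟨ cong (λ l → flips l (not up)) (+-suc k (k ℕ.+ 0)) ⟩
  flips (2 * k) (not (not up))          ≡⟨ flips-double k (not (not up)) ⟩
  not (not up)                          ≡⟨ not-involutive up ⟩
  up                                    ∎

flips-even-length : (n : ℕ) → 1 ≤ n → (up : Bool) → flips (2 * n ∸ 1) up ≡ not up
flips-even-length (suc k) _ up =
  trans (cong (λ l → flips l up) (+-suc k (k ℕ.+ 0))) (flips-double k (not up))

flips-odd-length : (n : ℕ) → 1 ≤ n → (up : Bool) → flips (2 * n ∸ 1 ∸ 1) up ≡ up
flips-odd-length (suc k) _ up =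
  trans (cong (λ l → flips (l ∸ 1) up) (+-suc k (k ℕ.+ 0))) (flips-double k up)

step : {n : ℕ} → Bool → Fin n → Fin n → Bool
step up x y = if up then lt x y else lt y x

step-not : {n : ℕ} (up : Bool) (x y : Fin n) → step (not up) x y ≡ step up y x
step-not true  x y = refl
step-not false x y = refl

step-opposite : {n : ℕ} (up : Bool) (x y : Fin n) →
                step up (opposite x) (opposite y) ≡ step (not up) x y
step-opposite true  x y = lt-opposite x y
step-opposite false x y = lt-opposite y x

alt-map-opposite : {n : ℕ} (up : Bool) (xs : List (Fin n)) →
                   alt up (List.map opposite xs) ≡ alt (not up) xs
alt-map-opposite up []           = refl
alt-map-opposite up (x ∷ [])     = refl
alt-map-opposite up (x ∷ y ∷ zs) =
  cong₂ _∧_ (step-opposite up x y) (alt-map-opposite (not up) (y ∷ zs))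

alt-++ : {n : ℕ} (up : Bool) (xs : List (Fin n)) (y : Fin n) (ys : List (Fin n)) →
         alt up (xs ++ y ∷ ys) ≡ alt up (xs ++ [ y ]) ∧ alt (flips (length xs) up) (y ∷ ys)
alt-++ up []            y ys = refl
alt-++ up (x ∷ [])      y ys = cong (_∧ alt (not up) (y ∷ ys)) (sym (∧-identityʳ (step up x y)))
alt-++ up (x ∷ x′ ∷ xs) y ys = trans
  (cong (step up x x′ ∧_) (alt-++ (not up) (x′ ∷ xs) y ys))
  (sym (∧-assoc (step up x x′) (alt (not up) (x′ ∷ xs ++ [ y ])) _))

alt-reverse : {n : ℕ} (up : Bool) (xs : List (Fin n)) →
              alt up (List.reverse xs) ≡ alt (flips (length xs ∸ 1) up) xs
alt-reverse up []           = refl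
alt-reverse up (x ∷ [])     = refl
alt-reverse up (x ∷ y ∷ zs) = begin
  alt up (List.reverse (x ∷ y ∷ zs))
    ≡⟨ cong (alt up) reverse-∷-∷ ⟩
  alt up (List.reverse zs ++ y ∷ [ x ])
    ≡⟨ alt-++ up (List.reverse zs) y [ x ] ⟩
  alt up (List.reverse zs ++ [ y ]) ∧ alt (flips (length (List.reverse zs)) up) (y ∷ [ x ])
    ≡⟨ cong₂ (λ a l → a ∧ alt (flips l up) (y ∷ [ x ]))
             (trans (cong (alt up) (sym (unfold-reverse y zs))) (alt-reverse up (y ∷ zs)))
             (length-reverse zs) ⟩
  alt B (y ∷ zs) ∧ (step B y x ∧ true)
    ≡⟨ cong (alt B (y ∷ zs) ∧_) (∧-identityʳ (step B y x)) ⟩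
  alt B (y ∷ zs) ∧ step B y x
    ≡⟨ ∧-comm (alt B (y ∷ zs)) (step B y x) ⟩
  step B y x ∧ alt B (y ∷ zs)
    ≡⟨ cong₂ _∧_ (sym (step-not B x y)) (cong (λ b → alt b (y ∷ zs)) (sym (not-involutive B))) ⟩
  alt (not B) (x ∷ y ∷ zs)
    ≡⟨ cong (λ b → alt b (x ∷ y ∷ zs)) (flips-not (length zs) up) ⟨
  alt (flips (length zs) (not up)) (x ∷ y ∷ zs) ∎
  where
  B : Bool
  B = flips (length zs) up

  reverse-∷-∷ : List.reverse (x ∷ y ∷ zs) ≡ List.reverse zs ++ y ∷ [ x ]
  reverse-∷-∷ = begin
    List.reverse (x ∷ y ∷ zs)           ≡⟨ unfold-reverse x (y ∷ zs) ⟩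
    List.reverse (y ∷ zs) ++ [ x ]      ≡⟨ cong (_++ [ x ]) (unfold-reverse y zs) ⟩
    (List.reverse zs ++ [ y ]) ++ [ x ] ≡⟨ ++-assoc (List.reverse zs) [ y ] [ x ] ⟩
    List.reverse zs ++ y ∷ [ x ]        ∎

isAlternating : {m k : ℕ} → Bool → Vec (Fin m) k → Bool
isAlternating up π = distinct (toList π) ∧ alt up (toList π)

isAlternating-reverse : {m k : ℕ} (up : Bool) (π : Vec (Fin m) k) →
                        isAlternating up (Vec.reverse π) ≡ isAlternating (flips (k ∸ 1) up) π
isAlternating-reverse {m} {k} up π = begin
  isAlternating up (Vec.reverse π)
    ≡⟨ cong (λ ys → distinct ys ∧ alt up ys) (toList-reverse π) ⟩
  distinct (List.reverse xs) ∧ alt up (List.reverse xs)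
    ≡⟨ cong₂ _∧_ (distinct-reverse xs) (alt-reverse up xs) ⟩
  distinct xs ∧ alt (flips (length xs ∸ 1) up) xs
    ≡⟨ cong (λ l → distinct xs ∧ alt (flips (l ∸ 1) up) xs) (length-toList π) ⟩
  isAlternating (flips (k ∸ 1) up) π ∎
  where
  xs : List (Fin m)
  xs = toList π

isAlternating-complement : {m k : ℕ} (up : Bool) (π : Vec (Fin m) k) →
                           isAlternating (not up) (Vec.map opposite π) ≡ isAlternating up π
isAlternating-complement {m} up π = begin
  isAlternating (not up) (Vec.map opposite π)
    ≡⟨ cong (λ ys → distinct ys ∧ alt (not up) ys) (toList-map opposite π) ⟩
  distinct (List.map opposite xs) ∧ alt (not up) (List.map opposite xs)
    ≡⟨ cong₂ _∧_ (distinct-map-opposite xs) (alt-map-opposite (not up) xs) ⟩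
  distinct xs ∧ alt (not (not up)) xs
    ≡⟨ cong (λ b → distinct xs ∧ alt b xs) (not-involutive up) ⟩
  isAlternating up π ∎
  where
  xs : List (Fin m)
  xs = toList π

module GF-Symmetries {c ℓ : Level} (R : CommutativeSemiring c ℓ)
                     (p q : CommutativeSemiring.Carrier R) where
  open CommutativeSemiring R using (_≈_; +-commutativeMonoid; reflexive)
    renaming (_*_ to _*ᴿ_; trans to ≈-trans)
  open Summation +-commutativeMonoid
    using (wordSum; wordSum-reverse; wordSum-permute; sumList-filter-words-transport)

  GF-transport :
    {m : ℕ} (φ : Vec (Fin m) m → Vec (Fin m) m) → (∀ h → wordSum m (h ∘ φ) ≈ wordSum m h) →
    {b₁ b₂ : Vec (Fin m) m → Bool} (f₁ g₁ f₂ g₂ : Vec (Fin m) m → ℕ) →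
    (∀ π → b₂ (φ π) ≡ b₁ π) → (∀ π → f₂ (φ π) ≡ f₁ π) → (∀ π → g₂ (φ π) ≡ g₁ π) →
    GF R (filter (λ π → b₁ π ≟ true) (words m m)) f₁ g₁ p q
    ≈ GF R (filter (λ π → b₂ π ≟ true) (words m m)) f₂ g₂ p q
  GF-transport φ φ-invariant f₁ g₁ f₂ g₂ b-eq f-eq g-eq =
    sumList-filter-words-transport φ φ-invariant b-eq
      (λ π → reflexive (cong₂ (λ i j → pow R p i *ᴿ pow R q j) (f-eq π) (g-eq π)))

  GF-reverse :
    {m : ℕ} {up up′ : Bool} → flips (m ∸ 1) up ≡ up′ → (f₁ g₁ f₂ g₂ : Vec (Fin m) m → ℕ) →
    (∀ π → f₂ (Vec.reverse π) ≡ f₁ π) → (∀ π → g₂ (Vec.reverse π) ≡ g₁ π) →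
    GF R (alternating up′ m) f₁ g₁ p q ≈ GF R (alternating up m) f₂ g₂ p q
  GF-reverse {m} {up} up-eq f₁ g₁ f₂ g₂ =
    GF-transport Vec.reverse (wordSum-reverse m) f₁ g₁ f₂ g₂
      (λ π → trans (isAlternating-reverse up π) (cong (λ u → isAlternating u π) up-eq))

  GF-complement :
    {m : ℕ} {up : Bool} (f₁ g₁ f₂ g₂ : Vec (Fin m) m → ℕ) →
    (∀ π → f₂ (Vec.map opposite π) ≡ f₁ π) → (∀ π → g₂ (Vec.map opposite π) ≡ g₁ π) →
    GF R (alternating up m) f₁ g₁ p q ≈ GF R (alternating (not up) m) f₂ g₂ p q
  GF-complement {m} {up} f₁ g₁ f₂ g₂ =
    GF-transport (Vec.map opposite) (wordSum-permute Perm.reverse m) f₁ g₁ f₂ g₂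
      (isAlternating-complement up)

  alternating-symmetries :
    (m : ℕ) {up r s : Bool} → flips (m ∸ 1) r ≡ up → flips (m ∸ 1) s ≡ not up →
      GF R (alternating up m) mII mI p q ≈ GF R (alternating r m) mI mII p q
    × GF R (alternating up m) mII mI p q ≈ GF R (alternating (not up) m) mIII mIV p q
    × GF R (alternating up m) mII mI p q ≈ GF R (alternating s m) mIV mIII p q
  alternating-symmetries m {up} r-eq s-eq =
      GF-reverse {m} r-eq mII mI mI mII (witnessCount-reverse-lt lt) (witnessCount-reverse-gt lt)
    , complement
    , ≈-trans complement
        (GF-reverse {m} s-eq mIII mIV mIV mIII
          (witnessCount-reverse-lt (flip lt)) (witnessCount-reverse-gt (flip lt)))
    where
    complement : GF R (alternating up m) mII mI p q ≈ GF R (alternating (not up) m) mIII mIV p q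
    complement = GF-complement {m} {up} mII mI mIII mIV
      (witnessCount-complement (flip lt)) (witnessCount-complement lt)

proposition2 : {c ℓ : Level} (R : CommutativeSemiring c ℓ) (n : ℕ) → 1 ≤ n →
    (p q : CommutativeSemiring.Carrier R) →
    let open CommutativeSemiring R using (_≈_) in
    -- 1. A_{2n}
    (GF R (UD (2 * n)) mII mI p q ≈ GF R (DU (2 * n)) mI mII p q
      × GF R (UD (2 * n)) mII mI p q ≈ GF R (DU (2 * n)) mIII mIV p q
      × GF R (UD (2 * n)) mII mI p q ≈ GF R (UD (2 * n)) mIV mIII p q)
    -- 2. B_{2n-1}
    × (GF R (UD (2 * n ∸ 1)) mII mI p q ≈ GF R (UD (2 * n ∸ 1)) mI mII p q
      × GF R (UD (2 * n ∸ 1)) mII mI p q ≈ GF R (DU (2 * n ∸ 1)) mIII mIV p q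
      × GF R (UD (2 * n ∸ 1)) mII mI p q ≈ GF R (DU (2 * n ∸ 1)) mIV mIII p q)
    -- 3. C_{2n}
    × (GF R (DU (2 * n)) mII mI p q ≈ GF R (UD (2 * n)) mI mII p q
      × GF R (DU (2 * n)) mII mI p q ≈ GF R (UD (2 * n)) mIII mIV p q
      × GF R (DU (2 * n)) mII mI p q ≈ GF R (DU (2 * n)) mIV mIII p q)
    -- 4. D_{2n-1}
    × (GF R (DU (2 * n ∸ 1)) mII mI p q ≈ GF R (DU (2 * n ∸ 1)) mI mII p q
      × GF R (DU (2 * n ∸ 1)) mII mI p q ≈ GF R (UD (2 * n ∸ 1)) mIII mIV p q
      × GF R (DU (2 * n ∸ 1)) mII mI p q ≈ GF R (UD (2 * n ∸ 1)) mIV mIII p q)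
proposition2 R n 1≤n p q =
    alternating-symmetries (2 * n)     (even false) (even true)
  , alternating-symmetries (2 * n ∸ 1) (odd true)   (odd false)
  , alternating-symmetries (2 * n)     (even true)  (even false)
  , alternating-symmetries (2 * n ∸ 1) (odd false)  (odd true)
  where
  open GF-Symmetries R p q

  even : (up : Bool) → flips (2 * n ∸ 1) up ≡ not up
  even = flips-even-length n 1≤n

  odd : (up : Bool) → flips (2 * n ∸ 1 ∸ 1) up ≡ up
  odd = flips-odd-length n 1≤n
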